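{- Let $G$ be an $r$-regular graph on $n$ vertices with $\theta(G)=1$ and $r\equiv n\equiv 2 \pmod 4$. Let $a\in\{1,\dots,n\}$ and $S=\{1,2,\dots,n+1\}\setminus\{a\}$ be such that $G$ is $S$-magic. Then $a$ is an even integer, and $a\neq 2$ and $a\neq n$.
   Context: For a finite set $S$ of positive integers with $|S|=|V(G)|$, a graph $G$ is $S$-magic if there is a bijection $f:V(G)\to S$ and a constant $c$ (the $S$-magic constant) with $\sum_{v\in N(u)} f(v)=c$ for every vertex $u$, where $N(u)$ is the set of neighbours of $u$. Let $\alpha(S)=\max S$ and $i(G)=\min \alpha(S)$ over all $S$ for which $G$ is $S$-magic; the distance magic index is $\theta(G)=i(G)-|V(G)|$ (and $\theta(G)=\infty$ if no such $S$ exists). If $\theta(G)=1$, then $G$ is $S$-magic for some $S=\{1,\dots,n+1\}\setminus\{a\}$ with $a\in\{1,\dots,n\}$; $a$ is called the deleted label of $S$. -}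

module Defs where

open import Data.Nat using (ℕ; zero; suc; _+_; _≤_)
open import Data.Bool using (Bool; true; false; if_then_else_)
open import Data.Fin using (Fin)
open import Data.List using (List; map; allFin)
open import Data.Nat.ListAction using (sum)
open import Data.Product using (Σ; _×_; ∃)
open import Relation.Binary.PropositionalEquality using (_≡_; _≢_)
open import Relation.Nullary using (¬_)
open import Function.Definitions using (Injective)

record Graph (n : ℕ) : Set where
  field
    adj   : Fin n → Fin n → Bool
    sym   : ∀ u v → adj u v ≡ adj v u
    loopless : ∀ u → adj u u ≡ false
open Graph public

deg : ∀ {n} → Graph n → Fin n → ℕ
deg {n} G u = sum (map (λ v → if adj G u v then 1 else 0) (allFin n))

Regular : ∀ {n} → Graph n → ℕ → Set
Regular G r = ∀ u → deg G u ≡ r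

nbrSum : ∀ {n} → Graph n → (Fin n → ℕ) → Fin n → ℕ
nbrSum {n} G f u = sum (map (λ v → if adj G u v then f v else 0) (allFin n))

IsMagic : ∀ {n} → Graph n → (Fin n → ℕ) → Set
IsMagic G f = ∃ λ c → ∀ u → nbrSum G f u ≡ c

-- G is S-magic for some set S of n positive integers with max S ≤ m
-- (S is the image of the injective labelling f).
MagicWithMaxAtMost : ∀ {n} → Graph n → ℕ → Set
MagicWithMaxAtMost {n} G m =
  Σ (Fin n → ℕ) λ f →
    Injective _≡_ _≡_ f × (∀ v → 1 ≤ f v) × (∀ v → f v ≤ m) × IsMagic G f

-- θ(G) = 1, i.e. i(G) = n + 1: some S with max S = n+1 works,
-- and no S with max S ≤ n works.
ThetaIsOne : ∀ {n} → Graph n → Set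
ThetaIsOne {n} G = MagicWithMaxAtMost G (suc n) × ¬ MagicWithMaxAtMost G n

IsSMagicDeleted : ∀ {n} → Graph n → ℕ → Set
IsSMagicDeleted {n} G a =
  Σ (Fin n → ℕ) λ f →
    Injective _≡_ _≡_ f
    × (∀ v → 1 ≤ f v × f v ≤ suc n × f v ≢ a)
    × (∀ s → 1 ≤ s → s ≤ suc n → s ≢ a → ∃ λ v → f v ≡ s)
    × IsMagic G f

-- Write n = 2d and r = 2y with d and y odd, so y < d, and let F = (2d+1)(d+1) − a be the sum
-- of the labels. Summing the neighbourhood sums over all vertices gives n c = r F, i.e. d c = y F.
-- Summing f(u) c over all u counts every edge uv twice with weight f(u) f(v), so F c is even;
-- since y is odd this forces F to be even, and as (2d+1)(d+1) is even, so is a.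
-- For a = 2 one gets F ≡ −1 and for a = n one gets F ≡ 1 modulo d; either way d c = y F
-- makes d divide y, which is impossible for 0 < y < d.
module Submission where

open import Defs hiding (sym)
open import Data.Nat using (ℕ; _≤_; _%_)
open import Data.Nat.Divisibility using (_∣_)
open import Data.Product using (_×_)
open import Relation.Binary.PropositionalEquality using (_≡_; _≢_)

open import Data.Bool using (true; false; if_then_else_)
open import Data.Fin using (Fin; zero; suc; fromℕ<)
open import Data.List using ([]; _∷_; map; tabulate; allFin; applyDownFrom)
open import Data.List.Membership.Propositional using (_∈_)
open import Data.List.Membership.Propositional.Properties
  using (∈-tabulate⁺; ∈-tabulate⁻; ∈-applyDownFrom⁺; ∈-applyDownFrom⁻)
open import Data.List.Membership.Propositional.Properties.WithK using (unique∧set⇒bag)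
open import Data.List.Properties using (map-tabulate)
open import Data.List.Relation.Binary.BagAndSetEquality using (∼bag⇒↭)
open import Data.List.Relation.Binary.Permutation.Propositional using (_↭_)
import Data.List.Relation.Unary.All as All
open import Data.List.Relation.Unary.Any using (here; there)
import Data.List.Relation.Unary.AllPairs as AllPairs
open import Data.List.Relation.Unary.Unique.Propositional using (Unique)
open import Data.List.Relation.Unary.Unique.Propositional.Properties
  using (tabulate⁺; applyDownFrom⁺₁)
open import Data.Nat using (zero; suc; _+_; _*_; _<_; s≤s; z≤n; >-nonZero)
open import Data.Nat.DivMod using (m≡m%n+[m/n]*n; [m+kn]%n≡m%n; _/_)
open import Data.Nat.Divisibility
  using (divides; ∣-trans; ∣m∣n⇒∣m+n; ∣m+n∣m⇒∣n; m∣m*n; n∣m*n; n∣m⇒m%n≡0; >⇒∤)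
open import Data.Nat.ListAction using (sum)
open import Data.Nat.ListAction.Properties using (sum-↭)
open import Data.Nat.Primality using (Prime; prime?; euclidsLemma)
open import Data.Nat.Properties
open import Algebra.Properties.Semiring.Sum +-*-semiring
  using (sum-syntax; sum-cong-≗; ∑-distrib-+; ∑-comm; *-distribˡ-sum; *-distribʳ-sum)
open import Data.Nat.Tactic.RingSolver using (solve)
open import Data.Product using (_,_; ∃; proj₁; proj₂; uncurry)
open import Data.Sum using (inj₁; inj₂)
open import Function using (_∘_; id; Injective)
open import Function.Bundles using (mk⇔)
open import Relation.Binary.PropositionalEquality
  using (refl; sym; trans; cong; cong₂; subst; module ≡-Reasoning)
open import Relation.Nullary using (¬_; yes; no; contradiction)
open import Relation.Nullary.Decidable using (toWitness)

open ≡-Reasoning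

sum-tabulate : ∀ {n} (g : Fin n → ℕ) → sum (tabulate g) ≡ ∑[ i < n ] g i
sum-tabulate {zero}  g = refl
sum-tabulate {suc n} g = cong (g zero +_) (sum-tabulate (g ∘ suc))

sum-map-allFin : ∀ n (g : Fin n → ℕ) → sum (map g (allFin n)) ≡ ∑[ i < n ] g i
sum-map-allFin n g = trans (cong sum (map-tabulate id g)) (sum-tabulate g)

∑-const : ∀ n c → ∑[ i < n ] c ≡ n * c
∑-const zero    c = refl
∑-const (suc n) c = cong (c +_) (∑-const n c)

∑∑-symmetric-even : ∀ {n} (M : Fin n → Fin n → ℕ) →
  (∀ u v → M u v ≡ M v u) → (∀ u → M u u ≡ 0) → 2 ∣ ∑[ u < n ] ∑[ v < n ] M u v
∑∑-symmetric-even {zero}  M symmetric diagonal = divides 0 refl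
∑∑-symmetric-even {suc n} M symmetric diagonal =
  subst (2 ∣_) (sym split) (∣m∣n⇒∣m+n (m∣m*n row) (∑∑-symmetric-even M′ symmetric′ diagonal′))
  where
  M′ : Fin n → Fin n → ℕ
  M′ u v = M (suc u) (suc v)
  symmetric′ : ∀ u v → M′ u v ≡ M′ v u
  symmetric′ u v = symmetric (suc u) (suc v)
  diagonal′ : ∀ u → M′ u u ≡ 0
  diagonal′ u = diagonal (suc u)
  row : ℕ
  row = ∑[ v < n ] M zero (suc v)
  rest : ℕ
  rest = ∑[ u < n ] ∑[ v < n ] M′ u v
  split : ∑[ u < suc n ] ∑[ v < suc n ] M u v ≡ 2 * row + rest
  split = begin
    M zero zero + row + ∑[ u < n ] (M (suc u) zero + ∑[ v < n ] M′ u v)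
      ≡⟨ cong₂ (λ x y → x + row + y) (diagonal zero)
           (∑-distrib-+ (λ u → M (suc u) zero) (λ u → ∑[ v < n ] M′ u v)) ⟩
    row + (∑[ u < n ] M (suc u) zero + rest)
      ≡⟨ cong (λ x → row + (x + rest)) (sum-cong-≗ (λ u → symmetric (suc u) zero)) ⟩
    row + (row + rest)
      ≡⟨ +-assoc row row rest ⟨
    row + row + rest
      ≡⟨ cong (λ x → row + x + rest) (+-identityʳ row) ⟨
    2 * row + rest ∎

∑-pointwise≤1⇒≤ : ∀ {n} (g : Fin n → ℕ) → (∀ v → g v ≤ 1) → ∑[ v < n ] g v ≤ n
∑-pointwise≤1⇒≤ {zero}  g g≤1 = z≤n
∑-pointwise≤1⇒≤ {suc n} g g≤1 = +-mono-≤ (g≤1 zero) (∑-pointwise≤1⇒≤ (g ∘ suc) (g≤1 ∘ suc))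

∑-pointwise≤1-with-zero⇒< : ∀ {n} (g : Fin n → ℕ) (w : Fin n) →
  (∀ v → g v ≤ 1) → g w ≡ 0 → ∑[ v < n ] g v < n
∑-pointwise≤1-with-zero⇒< {suc n} g zero g≤1 gw≡0 =
  subst (_< suc n) (cong (_+ ∑[ v < n ] g (suc v)) (sym gw≡0))
    (s≤s (∑-pointwise≤1⇒≤ (g ∘ suc) (g≤1 ∘ suc)))
∑-pointwise≤1-with-zero⇒< {suc n} g (suc w) g≤1 gw≡0 =
  +-mono-≤-< (g≤1 zero) (∑-pointwise≤1-with-zero⇒< (g ∘ suc) w (g≤1 ∘ suc) gw≡0)

if-then-else-0≡*indicator : ∀ b x → (if b then x else 0) ≡ x * (if b then 1 else 0)
if-then-else-0≡*indicator true  x = sym (*-identityʳ x)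
if-then-else-0≡*indicator false x = sym (*-zeroʳ x)

indicator≤1 : ∀ b → (if b then 1 else 0) ≤ 1
indicator≤1 true  = ≤-refl
indicator≤1 false = z≤n

module _ {n : ℕ} (G : Graph n) where

  nbrSum≡∑ : ∀ (g : Fin n → ℕ) u → nbrSum G g u ≡ ∑[ v < n ] (if adj G u v then g v else 0)
  nbrSum≡∑ g u = sum-map-allFin n _

  ∑-column≡*deg : ∀ (g : Fin n → ℕ) v → ∑[ u < n ] (if adj G u v then g v else 0) ≡ g v * deg G v
  ∑-column≡*deg g v = begin
    ∑[ u < n ] (if adj G u v then g v else 0)
      ≡⟨ sum-cong-≗ (λ u → cong (λ b → if b then g v else 0) (Graph.sym G u v)) ⟩
    ∑[ u < n ] (if adj G v u then g v else 0)
      ≡⟨ sum-cong-≗ (λ u → if-then-else-0≡*indicator (adj G v u) (g v)) ⟩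
    ∑[ u < n ] (g v * (if adj G v u then 1 else 0))
      ≡⟨ *-distribˡ-sum (g v) (λ u → if adj G v u then 1 else 0) ⟨
    g v * ∑[ u < n ] (if adj G v u then 1 else 0)
      ≡⟨ cong (g v *_) (sum-map-allFin n _) ⟨
    g v * deg G v ∎

  ∑-nbrSum : ∀ {r} → Regular G r → ∀ (g : Fin n → ℕ) → ∑[ u < n ] nbrSum G g u ≡ r * ∑[ v < n ] g v
  ∑-nbrSum {r} regular g = begin
    ∑[ u < n ] nbrSum G g u
      ≡⟨ sum-cong-≗ (nbrSum≡∑ g) ⟩
    ∑[ u < n ] ∑[ v < n ] (if adj G u v then g v else 0)
      ≡⟨ ∑-comm (λ u v → if adj G u v then g v else 0) ⟩
    ∑[ v < n ] ∑[ u < n ] (if adj G u v then g v else 0)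
      ≡⟨ sum-cong-≗ (∑-column≡*deg g) ⟩
    ∑[ v < n ] (g v * deg G v)
      ≡⟨ sum-cong-≗ (λ v → trans (cong (g v *_) (regular v)) (*-comm (g v) r)) ⟩
    ∑[ v < n ] (r * g v)
      ≡⟨ *-distribˡ-sum r g ⟨
    r * ∑[ v < n ] g v ∎

  2∣∑*nbrSum : ∀ (g : Fin n → ℕ) → 2 ∣ ∑[ u < n ] (g u * nbrSum G g u)
  2∣∑*nbrSum g = subst (2 ∣_) (sym (sum-cong-≗ expand)) (∑∑-symmetric-even M symmetric diagonal)
    where
    M : Fin n → Fin n → ℕ
    M u v = g u * (if adj G u v then g v else 0)
    expand : ∀ u → g u * nbrSum G g u ≡ ∑[ v < n ] M u v
    expand u = trans (cong (g u *_) (nbrSum≡∑ g u))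
                     (*-distribˡ-sum (g u) (λ v → if adj G u v then g v else 0))
    symmetric : ∀ u v → M u v ≡ M v u
    symmetric u v rewrite Graph.sym G u v with adj G v u
    ... | true  = *-comm (g u) (g v)
    ... | false = trans (*-zeroʳ (g u)) (sym (*-zeroʳ (g v)))
    diagonal : ∀ u → M u u ≡ 0
    diagonal u rewrite loopless G u = *-zeroʳ (g u)

  magic⇒2∣∑*c : ∀ {f : Fin n → ℕ} {c} → (∀ u → nbrSum G f u ≡ c) → 2 ∣ (∑[ v < n ] f v) * c
  magic⇒2∣∑*c {f} {c} magic = subst (2 ∣_) sums-agree (2∣∑*nbrSum f)
    where
    sums-agree : ∑[ u < n ] (f u * nbrSum G f u) ≡ (∑[ v < n ] f v) * c
    sums-agree = begin
      ∑[ u < n ] (f u * nbrSum G f u) ≡⟨ sum-cong-≗ (λ u → cong (f u *_) (magic u)) ⟩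
      ∑[ u < n ] (f u * c)          ≡⟨ *-distribʳ-sum c f ⟨
      (∑[ v < n ] f v) * c          ∎

  regular⇒degree<n : ∀ {r} → Regular G r → 0 < n → r < n
  regular⇒degree<n regular 0<n =
    subst (_< n) (trans (sym (sum-map-allFin n _)) (regular w))
      (∑-pointwise≤1-with-zero⇒< _ w (λ v → indicator≤1 (adj G w v))
        (cong (λ b → if b then 1 else 0) (loopless G w)))
    where
    w : Fin n
    w = fromℕ< 0<n

∈-applyDownFrom-suc⁺ : ∀ {m x} → 1 ≤ x → x ≤ m → x ∈ applyDownFrom suc m
∈-applyDownFrom-suc⁺ {x = suc i} _ i<m = ∈-applyDownFrom⁺ suc i<m

∈-applyDownFrom-suc⁻ : ∀ {m x} → x ∈ applyDownFrom suc m → 1 ≤ x × x ≤ m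
∈-applyDownFrom-suc⁻ x∈ with _ , i<m , refl ← ∈-applyDownFrom⁻ suc x∈ = s≤s z≤n , i<m

applyDownFrom-suc-unique : ∀ m → Unique (applyDownFrom suc m)
applyDownFrom-suc-unique m =
  applyDownFrom⁺₁ suc m (λ j<i _ eq → <⇒≢ j<i (sym (suc-injective eq)))

2*sum-applyDownFrom-suc : ∀ m → 2 * sum (applyDownFrom suc m) ≡ m * suc m
2*sum-applyDownFrom-suc zero    = refl
2*sum-applyDownFrom-suc (suc m) = begin
  2 * (suc m + sum (applyDownFrom suc m))   ≡⟨ *-distribˡ-+ 2 (suc m) _ ⟩
  2 * suc m + 2 * sum (applyDownFrom suc m) ≡⟨ cong (2 * suc m +_) (2*sum-applyDownFrom-suc m) ⟩
  2 * suc m + m * suc m                     ≡⟨ *-distribʳ-+ (suc m) 2 m ⟨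
  (2 + m) * suc m                           ≡⟨ *-comm (2 + m) (suc m) ⟩
  suc m * suc (suc m)                       ∎

deleted-labels↭ : ∀ {n a} {f : Fin n → ℕ} → Injective _≡_ _≡_ f →
  (∀ v → 1 ≤ f v × f v ≤ suc n × f v ≢ a) →
  (∀ s → 1 ≤ s → s ≤ suc n → s ≢ a → ∃ λ v → f v ≡ s) →
  1 ≤ a → a ≤ suc n → a ∷ tabulate f ↭ applyDownFrom suc (suc n)
deleted-labels↭ {n} {a} {f} f-injective f-range f-onto 1≤a a≤1+n =
  ∼bag⇒↭ (unique∧set⇒bag unique (applyDownFrom-suc-unique (suc n)) (mk⇔ to from))
  where
  a∉labels : ∀ {x} → x ∈ tabulate f → a ≢ x
  a∉labels x∈ a≡x with i , refl ← ∈-tabulate⁻ x∈ = proj₂ (proj₂ (f-range i)) (sym a≡x)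
  unique : Unique (a ∷ tabulate f)
  unique = All.tabulate a∉labels AllPairs.∷ tabulate⁺ f-injective
  to : ∀ {x} → x ∈ a ∷ tabulate f → x ∈ applyDownFrom suc (suc n)
  to (here refl) = ∈-applyDownFrom-suc⁺ 1≤a a≤1+n
  to (there x∈) with i , refl ← ∈-tabulate⁻ x∈ =
    ∈-applyDownFrom-suc⁺ (proj₁ (f-range i)) (proj₁ (proj₂ (f-range i)))
  from : ∀ {x} → x ∈ applyDownFrom suc (suc n) → x ∈ a ∷ tabulate f
  from {x} x∈ with x ≟ a
  ... | yes refl = here refl
  ... | no x≢a with v , refl ← uncurry (f-onto x) (∈-applyDownFrom-suc⁻ x∈) x≢a =
    there (∈-tabulate⁺ v)

sum-↭-cons-tabulate : ∀ {n a xs} {f : Fin n → ℕ} → a ∷ tabulate f ↭ xs →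
  a + ∑[ v < n ] f v ≡ sum xs
sum-↭-cons-tabulate {a = a} {f = f} a∷f↭xs =
  trans (cong (a +_) (sym (sum-tabulate f))) (sum-↭ a∷f↭xs)

2-prime : Prime 2
2-prime = toWitness {a? = prime? 2} _

¬2∣1+k*2 : ∀ k → ¬ 2 ∣ 1 + k * 2
¬2∣1+k*2 k 2∣1+k*2 = 0≢1+n (trans (sym (n∣m⇒m%n≡0 _ 2 2∣1+k*2)) ([m+kn]%n≡m%n 1 k 2))

%4≡2⇒≡[1+k*2]*2 : ∀ m → m % 4 ≡ 2 → ∃ λ k → m ≡ (1 + k * 2) * 2
%4≡2⇒≡[1+k*2]*2 m m%4≡2 = m / 4 , (begin
  m                 ≡⟨ m≡m%n+[m/n]*n m 4 ⟩
  m % 4 + m / 4 * 4 ≡⟨ cong (_+ m / 4 * 4) m%4≡2 ⟩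
  2 + m / 4 * 4     ≡⟨ cong (2 +_) (*-assoc (m / 4) 2 2) ⟨
  (1 + m / 4 * 2) * 2 ∎)

∣m*n∧∣m*[1+n]⇒∣m : ∀ {d m n} → d ∣ m * n → d ∣ m * suc n → d ∣ m
∣m*n∧∣m*[1+n]⇒∣m {d} {m} {n} d∣m*n d∣m*[1+n] =
  ∣m+n∣m⇒∣n (subst (d ∣_) (trans (*-suc m n) (+-comm m (m * n))) d∣m*[1+n]) d∣m*n

-- Since d ∤ y, the label sum F cannot be ±1 modulo d.
module _ {d y c F : ℕ} (0<y : 0 < y) (y<d : y < d) (d*c≡y*F : d * c ≡ y * F) where

  private
    d∣y*F : d ∣ y * F
    d∣y*F = divides c (trans (sym d*c≡y*F) (*-comm d c))

    d∣y*[d*t] : ∀ t → d ∣ y * (d * t)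
    d∣y*[d*t] t = ∣-trans (m∣m*n t) (n∣m*n y)

    d∤y : ¬ d ∣ y
    d∤y = >⇒∤ {{>-nonZero 0<y}} y<d

  1+F≢d*t : ∀ t → 1 + F ≢ d * t
  1+F≢d*t t 1+F≡d*t =
    d∤y (∣m*n∧∣m*[1+n]⇒∣m d∣y*F (subst (λ x → d ∣ y * x) (sym 1+F≡d*t) (d∣y*[d*t] t)))

  F≢1+d*t : ∀ t → F ≢ 1 + d * t
  F≢1+d*t t F≡1+d*t =
    d∤y (∣m*n∧∣m*[1+n]⇒∣m (d∣y*[d*t] t) (subst (λ x → d ∣ y * x) F≡1+d*t d∣y*F))

2∣F*c⇒2∣F : ∀ {d y c F} → ¬ 2 ∣ y → d * c ≡ y * F → 2 ∣ F * c → 2 ∣ F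
2∣F*c⇒2∣F {d} {y} {c} {F} 2∤y d*c≡y*F 2∣F*c with euclidsLemma F c 2-prime 2∣F*c
... | inj₁ 2∣F = 2∣F
... | inj₂ 2∣c with euclidsLemma y F 2-prime (subst (2 ∣_) d*c≡y*F (∣-trans 2∣c (n∣m*n d)))
...   | inj₁ 2∣y = contradiction 2∣y 2∤y
...   | inj₂ 2∣F = 2∣F

deleted-label-constraints : ∀ {d y a c F} → 2 ∣ 1 + d → ¬ 2 ∣ y → y < d →
  d * c ≡ y * F → 2 ∣ F * c → a + F ≡ (1 + d * 2) * (1 + d) →
  (2 ∣ a) × a ≢ 2 × a ≢ d * 2
deleted-label-constraints {d} {y} {a} {c} {F} 2∣1+d 2∤y y<d d*c≡y*F 2∣F*c a+F≡ =
  2∣a , a≢2 , a≢d*2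
  where
  0<y : 0 < y
  0<y = n≢0⇒n>0 (λ y≡0 → 2∤y (subst (2 ∣_) (sym y≡0) (divides 0 refl)))

  2∣a : 2 ∣ a
  2∣a = ∣m+n∣m⇒∣n 2∣F+a (2∣F*c⇒2∣F {d} 2∤y d*c≡y*F 2∣F*c)
    where
    2∣F+a : 2 ∣ F + a
    2∣F+a = subst (2 ∣_) (trans (sym a+F≡) (+-comm a F)) (∣-trans 2∣1+d (n∣m*n (1 + d * 2)))

  a≢2 : a ≢ 2
  a≢2 a≡2 = 1+F≢d*t 0<y y<d d*c≡y*F (3 + d * 2) (suc-injective (begin
    2 + F                   ≡⟨ cong (_+ F) a≡2 ⟨
    a + F                   ≡⟨ a+F≡ ⟩
    (1 + d * 2) * (1 + d)   ≡⟨ solve (d ∷ []) ⟩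
    1 + d * (3 + d * 2)     ∎))

  a≢d*2 : a ≢ d * 2
  a≢d*2 a≡d*2 = F≢1+d*t 0<y y<d d*c≡y*F (1 + d * 2) (+-cancelˡ-≡ (d * 2) F _ (begin
    d * 2 + F                   ≡⟨ cong (_+ F) a≡d*2 ⟨
    a + F                       ≡⟨ a+F≡ ⟩
    (1 + d * 2) * (1 + d)       ≡⟨ solve (d ∷ []) ⟩
    d * 2 + (1 + d * (1 + d * 2)) ∎))

deleted-label-constraints-mod4 : ∀ {n r a c F} → n % 4 ≡ 2 → r % 4 ≡ 2 → r < n →
  n * c ≡ r * F → 2 ∣ F * c → 2 * (a + F) ≡ suc n * suc (suc n) →
  (2 ∣ a) × a ≢ 2 × a ≢ n
deleted-label-constraints-mod4 {n} {r} {a} {c} {F} n%4≡2 r%4≡2 r<n n*c≡r*F 2∣F*c label-total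
  with k , refl ← %4≡2⇒≡[1+k*2]*2 n n%4≡2 | j , refl ← %4≡2⇒≡[1+k*2]*2 r r%4≡2 =
  deleted-label-constraints (n∣m*n (suc k)) (¬2∣1+k*2 j) (*-cancelʳ-< 2 _ _ r<n)
    d*c≡y*F 2∣F*c a+F≡
  where
  d*c≡y*F : (1 + k * 2) * c ≡ (1 + j * 2) * F
  d*c≡y*F = *-cancelˡ-≡ _ _ 2 (begin
    2 * ((1 + k * 2) * c)   ≡⟨ solve (k ∷ c ∷ []) ⟩
    (1 + k * 2) * 2 * c     ≡⟨ n*c≡r*F ⟩
    (1 + j * 2) * 2 * F     ≡⟨ solve (j ∷ F ∷ []) ⟩
    2 * ((1 + j * 2) * F)   ∎)
  a+F≡ : a + F ≡ (1 + (1 + k * 2) * 2) * (2 + k * 2)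
  a+F≡ = *-cancelˡ-≡ _ _ 2 (trans label-total (solve (k ∷ [])))

-- θ(G) = 1 only guarantees that some deleted label exists; the argument needs just the given labelling.
lemma2 : (n r : ℕ) (G : Graph n) → Regular G r → ThetaIsOne G
    → r % 4 ≡ 2 → n % 4 ≡ 2
    → (a : ℕ) → 1 ≤ a → a ≤ n → IsSMagicDeleted G a
    → (2 ∣ a) × a ≢ 2 × a ≢ n
lemma2 n r G regular _ r%4≡2 n%4≡2 a 1≤a a≤n (f , f-injective , f-range , f-onto , c , magic) =
  deleted-label-constraints-mod4 n%4≡2 r%4≡2 r<n n*c≡r*F (magic⇒2∣∑*c G magic) label-total
  where
  F : ℕ
  F = ∑[ v < n ] f v

  r<n : r < n
  r<n = regular⇒degree<n G regular (≤-trans 1≤a a≤n)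

  n*c≡r*F : n * c ≡ r * F
  n*c≡r*F = begin
    n * c                   ≡⟨ ∑-const n c ⟨
    ∑[ u < n ] c            ≡⟨ sum-cong-≗ magic ⟨
    ∑[ u < n ] nbrSum G f u ≡⟨ ∑-nbrSum G regular f ⟩
    r * F                   ∎

  label-total : 2 * (a + F) ≡ suc n * suc (suc n)
  label-total =
    trans (cong (2 *_) (sum-↭-cons-tabulate labels↭)) (2*sum-applyDownFrom-suc (suc n))
    where
    labels↭ : a ∷ tabulate f ↭ applyDownFrom suc (suc n)
    labels↭ = deleted-labels↭ f-injective f-range f-onto 1≤a (m≤n⇒m≤1+n a≤n)
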